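{- Suppose $1/n\ll\varepsilon_3\ll1$. Let $G$ be a digraph on $n$ vertices with $\delta^0(G)\geq n/2$. Suppose $A,B,S,T$ is a partition of $V(G)$ into sets of sizes $a,b,s,t$ satisfying (Q1)--(Q9) and $b=a+d$ for some $d>0$. Then there is a matching of size $d+2$ in $E(B\cup T,B)$.
   Context: Hierarchy notation: $1/n\ll\varepsilon_3\ll1$ means there are non-decreasing $f_0,f_1$ such that the statement holds whenever $\varepsilon_3\le f_1(1)$ and $1/n\le f_0(\varepsilon_3)$. Digraphs have no loops and at most one edge in each direction between two vertices; $\delta^0$ is the minimum semidegree; $d^\pm_X(x)$ are numbers of out-/inneighbours of $x$ in $X$ ($d^\pm_X(x)\ge c$ means both $\ge c$); $G[A,B]$ is the digraph on $A\cup B$ with all edges of $G$ between $A$ and $B$. $E(X,Y)$ is the set of edges $xy$ with $x\in X,y\in Y$; a matching is a set of pairwise vertex-disjoint edges. Conditions: (Q1) $a\le b$, $s\le t$; (Q2) $\lfloor n/2\rfloor-\varepsilon_3n\le a,b\le\lceil n/2\rceil+\varepsilon_3n$; (Q3) $\delta^0(G[A,B])\ge n/50$; (Q4) $d^\pm_B(x)\ge n/2-\varepsilon_3n$ for all but at most $\varepsilon_3n$ vertices $x\in A$; (Q5) $d^\pm_A(x)\ge n/2-\varepsilon_3n$ for all but at most $\varepsilon_3n$ vertices $x\in B$; (Q6) $s+t\le\varepsilon_3n$; (Q7) $d^-_A(x),d^+_B(x)\ge n/50$ for all $x\in S$; (Q8) $d^-_B(x),d^+_A(x)\ge n/50$ for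 all $x\in T$; (Q9) if $a<b$, then $d^\pm_B(x)<n/20$ for all $x\in B$, $d^-_B(x)<n/20$ for all $x\in S$ and $d^+_B(x)<n/20$ for all $x\in T$.
   Formalization: The parameter $\varepsilon_3$ ranges over the rationals, and the hierarchy functions $f_0,f_1$ are taken over the rationals. -}

module Defs where

open import Data.Nat using (ℕ; zero; suc; _+_; _*_; _≤_; _<_; _/_)
open import Data.Fin using (Fin; zero; suc)
open import Data.Bool using (Bool; true; false; _∧_; _∨_; if_then_else_)
open import Data.Integer using (+_)
open import Data.Rational using (ℚ; 0ℚ; 1ℚ; ½; _-_) renaming (_≤_ to _≤ℚ_; _<_ to _<ℚ_; _+_ to _+ℚ_; _*_ to _*ℚ_; _/_ to _/ℚ_)
open import Data.Product using (_×_; Σ; ∃; ∃-syntax)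
open import Relation.Binary.PropositionalEquality using (_≡_; _≢_)

ℕ→ℚ : ℕ → ℚ
ℕ→ℚ n = + n /ℚ 1

cnt : ∀ {n} → (Fin n → Bool) → ℕ
cnt {zero} f = 0
cnt {suc n} f = (if f zero then 1 else 0) + cnt (λ i → f (suc i))

-- A digraph on vertex set Fin n: Boolean adjacency (x → y edge iff adj x y ≡ true),
-- with no loops. At most one edge in each direction is automatic.
record Digraph (n : ℕ) : Set where
  field
    adj   : Fin n → Fin n → Bool
    loopless : ∀ x → adj x x ≡ false
open Digraph public

d⁺ : ∀ {n} → Digraph n → (Fin n → Bool) → Fin n → ℕ
d⁺ G X x = cnt (λ y → adj G x y ∧ X y)

d⁻ : ∀ {n} → Digraph n → (Fin n → Bool) → Fin n → ℕ
d⁻ G X x = cnt (λ y → adj G y x ∧ X y)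

Vall : ∀ {n} → Fin n → Bool
Vall _ = true

δ⁰≥half : ∀ {n} → Digraph n → Set
δ⁰≥half {n} G = ∀ x → (n ≤ 2 * d⁺ G Vall x) × (n ≤ 2 * d⁻ G Vall x)

data Part : Set where
  pA pB pS pT : Part

is : Part → Part → Bool
is pA pA = true
is pB pB = true
is pS pS = true
is pT pT = true
is _ _ = false

memb : ∀ {n} → (Fin n → Part) → Part → Fin n → Bool
memb P p x = is p (P x)

_≥n/50 : ℕ → ℕ → Set
(k ≥n/50) n = n ≤ 50 * k

_<n/20 : ℕ → ℕ → Set
(k <n/20) n = 20 * k < n

HierFun : (ℚ → ℚ) → Set
HierFun f = (∀ x y → 0ℚ <ℚ x → x ≤ℚ y → f x ≤ℚ f y) × (∀ x → 0ℚ <ℚ x → 0ℚ <ℚ f x)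

module _ {n : ℕ} (G : Digraph n) (P : Fin n → Part) (ε : ℚ) where
  private
    A = memb P pA
    B = memb P pB
    S = memb P pS
    T = memb P pT
    a = cnt A
    b = cnt B
    s = cnt S
    t = cnt T
    εn = ε *ℚ ℕ→ℚ n

  Q1 : Set
  Q1 = (a ≤ b) × (s ≤ t)

  Q2 : Set
  Q2 = (ℕ→ℚ (n / 2) - εn ≤ℚ ℕ→ℚ a) × (ℕ→ℚ a ≤ℚ ℕ→ℚ ((n + 1) / 2) +ℚ εn)
     × (ℕ→ℚ (n / 2) - εn ≤ℚ ℕ→ℚ b) × (ℕ→ℚ b ≤ℚ ℕ→ℚ ((n + 1) / 2) +ℚ εn)

  Q3 : Set
  Q3 = (∀ x → A x ≡ true → (d⁺ G B x ≥n/50) n × (d⁻ G B x ≥n/50) n)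
     × (∀ x → B x ≡ true → (d⁺ G A x ≥n/50) n × (d⁻ G A x ≥n/50) n)

  AllButFew : (Fin n → Bool) → (Fin n → Bool) → Set
  AllButFew X Y = ∃[ Exc ] (ℕ→ℚ (cnt Exc) ≤ℚ εn) ×
    (∀ x → X x ≡ true → Exc x ≡ false →
       (ℕ→ℚ n *ℚ ½ - εn ≤ℚ ℕ→ℚ (d⁺ G Y x)) × (ℕ→ℚ n *ℚ ½ - εn ≤ℚ ℕ→ℚ (d⁻ G Y x)))

  Q4 : Set
  Q4 = AllButFew A B

  Q5 : Set
  Q5 = AllButFew B A

  Q6 : Set
  Q6 = ℕ→ℚ (s + t) ≤ℚ εn

  Q7 : Set
  Q7 = ∀ x → S x ≡ true → (d⁻ G A x ≥n/50) n × (d⁺ G B x ≥n/50) n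

  Q8 : Set
  Q8 = ∀ x → T x ≡ true → (d⁻ G B x ≥n/50) n × (d⁺ G A x ≥n/50) n

  Q9 : Set
  Q9 = a < b →
         (∀ x → B x ≡ true → (d⁺ G B x <n/20) n × (d⁻ G B x <n/20) n)
       × (∀ x → S x ≡ true → (d⁻ G B x <n/20) n)
       × (∀ x → T x ≡ true → (d⁺ G B x <n/20) n)

  Q1-9 : Set
  Q1-9 = Q1 × Q2 × Q3 × Q4 × Q5 × Q6 × Q7 × Q8 × Q9

MatchingIn : ∀ {n} → Digraph n → (Fin n → Bool) → (Fin n → Bool) → ℕ → Set
MatchingIn {n} G X Y k = Σ (Fin k → Fin n) λ src → Σ (Fin k → Fin n) λ tgt →
    (∀ i → adj G (src i) (tgt i) ≡ true)
  × (∀ i → X (src i) ≡ true) × (∀ i → Y (tgt i) ≡ true)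
  × (∀ i j → src i ≡ src j → i ≡ j)
  × (∀ i j → tgt i ≡ tgt j → i ≡ j)
  × (∀ i j → src i ≢ tgt j)

-- Grow a matching from B ∪ T into B greedily and suppose it gets stuck at a
-- matching M with j ≤ d + 1 edges, so that every in-neighbour in B ∪ T of a
-- vertex of B ∖ V(M) lies in V(M). As δ⁰(G) ≥ n/2 and a + s ≤ (n − d)/2 (this
-- uses s ≤ t), every vertex has at least d/2 in-neighbours in B ∪ T, while by
-- (Q9) every vertex of B ∪ T has fewer than n/20 out-neighbours in B. Double
-- counting the edges from V(M) to B ∖ V(M) gives (d/2)(b − 2j) ≤ 2j·n/20.
-- This is impossible since b > a > 9n/20 − (s + t): a vertex of B has at least
-- n/2 out-neighbours but fewer than n/20 of them in B. The constants only need
-- s + t ≤ n/1000 and n ≥ 1000, which (Q6) and 1 ≤ εn give for ε ≤ 1/1000.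

module Submission where

open import Defs
open import Data.Nat using (ℕ; zero; suc; _+_; _*_; _≤_; _<_; z≤n; s≤s; >-nonZero)
open import Data.Nat.Properties hiding (_≟_)
open import Data.Nat.Tactic.RingSolver using (solve-∀)
open import Algebra.Properties.Semiring.Sum +-*-semiring using (sum; ∑-comm; sum-cong-≗; *-distribˡ-sum)
import Algebra.Properties.CommutativeSemigroup *-commutativeSemigroup as *-Comm
import Algebra.Properties.CommutativeSemigroup +-commutativeSemigroup as +-Comm
open import Data.Fin using (Fin; zero; suc)
open import Data.Fin.Properties using (_≟_; any?)
import Data.Vec.Functional as Vec
open import Data.Bool using (Bool; true; false; _∧_; _∨_; not; if_then_else_)
import Data.Bool.Properties as 𝔹
open 𝔹 using (∧-conicalˡ; ∧-conicalʳ)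
import Data.Integer as ℤ
import Data.Integer.Properties as ℤₚ
open import Data.Rational using (ℚ; mkℚ; 0ℚ; 1ℚ; NonNegative) renaming (_≤_ to _≤ℚ_; _<_ to _<ℚ_; _*_ to _*ℚ_; _/_ to _/ℚ_)
import Data.Rational.Properties as ℚₚ
open import Data.Nat.Coprimality using (1-coprimeTo)
import Data.Nat.Coprimality as Coprimality
open import Data.Product using (_×_; _,_; proj₁; proj₂; ∃; ∃-syntax)
open import Data.Empty using (⊥)
open import Data.Sum using (_⊎_; inj₁; inj₂; [_,_]′)
open import Function using (_∘_)
open import Relation.Nullary using (¬_; does; contradiction)
open import Relation.Nullary.Decidable using (Dec; _×-dec_; decidable-stable; dec-true)
open import Relation.Binary.PropositionalEquality using (_≡_; _≢_; refl; sym; trans; cong; cong₂; subst; subst₂; module ≡-Reasoning)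

infixr 6 _∩_ _∖_
infixr 5 _∪_
infix 4 _⊆_

_∪_ _∩_ _∖_ : ∀ {n} → (Fin n → Bool) → (Fin n → Bool) → Fin n → Bool
(X ∪ Y) x = X x ∨ Y x
(X ∩ Y) x = X x ∧ Y x
(X ∖ Y) x = X x ∧ not (Y x)

｛_｝ : ∀ {n} → Fin n → Fin n → Bool
｛ y ｝ x = does (y ≟ x)

⋃ : ∀ {k n} → (Fin k → Fin n → Bool) → Fin n → Bool
⋃ {zero} F x = false
⋃ {suc k} F x = F zero x ∨ ⋃ (F ∘ suc) x

_⊆_ : ∀ {n} → (Fin n → Bool) → (Fin n → Bool) → Set
X ⊆ Y = ∀ x → X x ≡ true → Y x ≡ true

∨-true : ∀ a b → a ∨ b ≡ true → a ≡ true ⊎ b ≡ true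
∨-true true b _ = inj₁ refl
∨-true false b h = inj₂ h

∧-intro : ∀ {a b} → a ≡ true → b ≡ true → a ∧ b ≡ true
∧-intro refl refl = refl

⊆-∪ˡ : ∀ {n} {X Y : Fin n → Bool} → X ⊆ X ∪ Y
⊆-∪ˡ {Y = Y} x h = subst (λ b → b ∨ Y x ≡ true) (sym h) refl

∪-false : ∀ {n} (X Y : Fin n → Bool) x → (X ∪ Y) x ≡ false → X x ≡ false × Y x ≡ false
∪-false X Y x h with X x | Y x
... | false | false = refl , refl

⋃-false : ∀ {k n} (F : Fin k → Fin n → Bool) x → ⋃ F x ≡ false → ∀ i → F i x ≡ false
⋃-false F x h zero = proj₁ (∪-false (F zero) (⋃ (F ∘ suc)) x h)
⋃-false F x h (suc i) = ⋃-false (F ∘ suc) x (proj₂ (∪-false (F zero) (⋃ (F ∘ suc)) x h)) i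

｛｝-false : ∀ {n} (y x : Fin n) → ｛ y ｝ x ≡ false → y ≢ x
｛｝-false y x h y≡x = contradiction (trans (sym (dec-true (y ≟ x) y≡x)) h) λ ()

𝟙 : Bool → ℕ
𝟙 b = if b then 1 else 0

cnt-none : ∀ {n} (X : Fin n → Bool) → (∀ x → X x ≡ false) → cnt X ≡ 0
cnt-none {zero} X _ = refl
cnt-none {suc n} X none rewrite none zero = cnt-none (X ∘ suc) (none ∘ suc)

cnt-｛｝ : ∀ {n} (y : Fin n) → cnt ｛ y ｝ ≡ 1
cnt-｛｝ {suc n} zero = cong suc (cnt-none {n} _ λ _ → refl)
cnt-｛｝ {suc n} (suc y) = cnt-｛｝ y

cnt-mono : ∀ {n} {X Y : Fin n → Bool} → X ⊆ Y → cnt X ≤ cnt Y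
cnt-mono {zero} _ = z≤n
cnt-mono {suc n} {X} {Y} X⊆Y = +-mono-≤ (𝟙-mono (X zero) (Y zero) (X⊆Y zero)) (cnt-mono (X⊆Y ∘ suc))
  where
  𝟙-mono : ∀ x y → (x ≡ true → y ≡ true) → 𝟙 x ≤ 𝟙 y
  𝟙-mono false y _ = z≤n
  𝟙-mono true y h rewrite h refl = ≤-refl

cnt-∪ : ∀ {n} (X Y : Fin n → Bool) → cnt (X ∪ Y) ≤ cnt X + cnt Y
cnt-∪ {zero} X Y = z≤n
cnt-∪ {suc n} X Y = ≤-trans
  (+-mono-≤ (𝟙-∨ (X zero) (Y zero)) (cnt-∪ (X ∘ suc) (Y ∘ suc)))
  (≤-reflexive (+-Comm.interchange (𝟙 (X zero)) (𝟙 (Y zero)) _ _))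
  where
  𝟙-∨ : ∀ x y → 𝟙 (x ∨ y) ≤ 𝟙 x + 𝟙 y
  𝟙-∨ false y = ≤-refl
  𝟙-∨ true y = s≤s z≤n

cnt-⋃ : ∀ {k n m} (F : Fin k → Fin n → Bool) → (∀ i → cnt (F i) ≤ m) → cnt (⋃ F) ≤ k * m
cnt-⋃ {zero} F _ = ≤-reflexive (cnt-none (⋃ F) λ _ → refl)
cnt-⋃ {suc k} F bound = ≤-trans (cnt-∪ (F zero) (⋃ (F ∘ suc))) (+-mono-≤ (bound zero) (cnt-⋃ (F ∘ suc) (bound ∘ suc)))

cnt≤cnt+cnt-∖ : ∀ {n} (X Y : Fin n → Bool) → cnt X ≤ cnt Y + cnt (X ∖ Y)
cnt≤cnt+cnt-∖ X Y = ≤-trans (cnt-mono split) (cnt-∪ Y (X ∖ Y))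
  where
  split : X ⊆ Y ∪ (X ∖ Y)
  split x h rewrite h with Y x
  ... | true = refl
  ... | false = refl

cnt-witness : ∀ {n} (X : Fin n → Bool) → 0 < cnt X → ∃ λ x → X x ≡ true
cnt-witness {suc n} X pos with X zero in eq
... | true = zero , eq
... | false = let (x , h) = cnt-witness (X ∘ suc) pos in suc x , h

cnt-parts : ∀ {n} (P : Fin n → Part) →
  cnt (memb P pA) + cnt (memb P pB) + cnt (memb P pS) + cnt (memb P pT) ≡ n
cnt-parts {zero} P = refl
cnt-parts {suc n} P with P zero | cnt-parts (P ∘ suc)
... | pA | IH = cong suc IH
... | pB | IH = trans (cong (λ k → k + count pS + count pT) (+-suc (count pA) (count pB))) (cong suc IH)
  where count = λ p → cnt (memb (P ∘ suc) p)
... | pS | IH = trans (cong (_+ count pT) (+-suc (count pA + count pB) (count pS))) (cong suc IH)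
  where count = λ p → cnt (memb (P ∘ suc) p)
... | pT | IH = trans (+-suc (count pA + count pB + count pS) (count pT)) (cong suc IH)
  where count = λ p → cnt (memb (P ∘ suc) p)

cnt≡sum : ∀ {n} (X : Fin n → Bool) → cnt X ≡ sum (𝟙 ∘ X)
cnt≡sum {zero} X = refl
cnt≡sum {suc n} X = cong (𝟙 (X zero) +_) (cnt≡sum (X ∘ suc))

cnt-double-counting : ∀ {n} (R : Fin n → Fin n → Bool) →
  sum (λ v → cnt (λ u → R u v)) ≡ sum (λ u → cnt (λ v → R u v))
cnt-double-counting R = begin
  sum (λ v → cnt (λ u → R u v))       ≡⟨ sum-cong-≗ (λ v → cnt≡sum (λ u → R u v)) ⟩
  sum (λ v → sum (λ u → 𝟙 (R u v)))   ≡⟨ ∑-comm (λ v u → 𝟙 (R u v)) ⟩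
  sum (λ u → sum (λ v → 𝟙 (R u v)))   ≡⟨ sum-cong-≗ (λ u → sym (cnt≡sum (R u))) ⟩
  sum (λ u → cnt (λ v → R u v))       ∎
  where open ≡-Reasoning

*-cnt≤sum : ∀ {n m} (X : Fin n → Bool) (w : Fin n → ℕ) → (∀ x → X x ≡ true → m ≤ w x) → m * cnt X ≤ sum w
*-cnt≤sum {zero} {m} X w _ = ≤-reflexive (*-zeroʳ m)
*-cnt≤sum {suc n} {m} X w low = ≤-trans
  (≤-reflexive (*-distribˡ-+ m (𝟙 (X zero)) _))
  (+-mono-≤ (head (X zero) (low zero)) (*-cnt≤sum (X ∘ suc) (w ∘ suc) (low ∘ suc)))
  where
  head : ∀ b → (b ≡ true → m ≤ w zero) → m * 𝟙 b ≤ w zero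
  head false _ rewrite *-zeroʳ m = z≤n
  head true h = ≤-trans (≤-reflexive (*-identityʳ m)) (h refl)

sum≤*-cnt : ∀ {n m} (X : Fin n → Bool) (w : Fin n → ℕ) →
  (∀ x → X x ≡ true → w x ≤ m) → (∀ x → X x ≡ false → w x ≡ 0) → sum w ≤ m * cnt X
sum≤*-cnt {zero} {m} X w _ _ = z≤n
sum≤*-cnt {suc n} {m} X w up zero-off = ≤-trans
  (+-mono-≤ (head (X zero) (up zero) (zero-off zero)) (sum≤*-cnt (X ∘ suc) (w ∘ suc) (up ∘ suc) (zero-off ∘ suc)))
  (≤-reflexive (sym (*-distribˡ-+ m (𝟙 (X zero)) _)))
  where
  head : ∀ b → (b ≡ true → w zero ≤ m) → (b ≡ false → w zero ≡ 0) → w zero ≤ m * 𝟙 b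
  head false _ h rewrite h refl = z≤n
  head true h _ = ≤-trans (h refl) (≤-reflexive (sym (*-identityʳ m)))

private
  ∧true-∨ : ∀ a b c → a ∧ true ≡ true → b ∨ c ≡ true → (a ∧ b) ∨ c ≡ true
  ∧true-∨ true true c _ _ = refl
  ∧true-∨ true false c _ h = h

d⁺-cover : ∀ {n} (G : Digraph n) {X Y : Fin n → Bool} → (∀ y → (X ∪ Y) y ≡ true) →
  ∀ x → d⁺ G Vall x ≤ d⁺ G X x + cnt Y
d⁺-cover G {X} {Y} cover x =
  ≤-trans (cnt-mono λ y h → ∧true-∨ (adj G x y) (X y) (Y y) h (cover y)) (cnt-∪ (λ y → adj G x y ∧ X y) Y)

d⁻-cover : ∀ {n} (G : Digraph n) {X Y : Fin n → Bool} → (∀ y → (X ∪ Y) y ≡ true) →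
  ∀ x → d⁻ G Vall x ≤ d⁻ G X x + cnt Y
d⁻-cover G {X} {Y} cover x =
  ≤-trans (cnt-mono λ y h → ∧true-∨ (adj G y x) (X y) (Y y) h (cover y)) (cnt-∪ (λ y → adj G y x ∧ X y) Y)

∷-injective : ∀ {k n} {x : Fin n} {f : Fin k → Fin n} → (∀ i → f i ≢ x) →
  (∀ i j → f i ≡ f j → i ≡ j) → ∀ i j → (x Vec.∷ f) i ≡ (x Vec.∷ f) j → i ≡ j
∷-injective fresh inj zero zero _ = refl
∷-injective fresh inj zero (suc j) eq = contradiction (sym eq) (fresh j)
∷-injective fresh inj (suc i) zero eq = contradiction eq (fresh i)
∷-injective fresh inj (suc i) (suc j) eq = cong suc (inj i j eq)

module _ {n} (G : Digraph n) (X Y : Fin n → Bool) where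

  covered : ∀ {k} → MatchingIn G X Y k → Fin n → Bool
  covered (src , tgt , _) = ⋃ λ i → ｛ src i ｝ ∪ ｛ tgt i ｝

  cnt-covered : ∀ {k} (M : MatchingIn G X Y k) → cnt (covered M) ≤ 2 * k
  cnt-covered {k} (src , tgt , _) = ≤-trans (cnt-⋃ (λ i → ｛ src i ｝ ∪ ｛ tgt i ｝) pair) (≤-reflexive (*-comm k 2))
    where
    pair : ∀ i → cnt (｛ src i ｝ ∪ ｛ tgt i ｝) ≤ 2
    pair i = ≤-trans (cnt-∪ ｛ src i ｝ ｛ tgt i ｝) (≤-reflexive (cong₂ _+_ (cnt-｛｝ (src i)) (cnt-｛｝ (tgt i))))

  covered-false : ∀ {k} (M : MatchingIn G X Y k) x → covered M x ≡ false →
    ∀ i → proj₁ M i ≢ x × proj₁ (proj₂ M) i ≢ x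
  covered-false (src , tgt , _) x h i =
    let (src-free , tgt-free) = ∪-false ｛ src i ｝ ｛ tgt i ｝ x (⋃-false _ x h i)
    in ｛｝-false (src i) x src-free , ｛｝-false (tgt i) x tgt-free

  Extension : ∀ {k} → MatchingIn G X Y k → Set
  Extension M = ∃[ u ] ∃[ v ] X u ≡ true × covered M u ≡ false × Y v ≡ true × covered M v ≡ false × adj G u v ≡ true

  extension? : ∀ {k} (M : MatchingIn G X Y k) → Dec (Extension M)
  extension? M = any? λ u → any? λ v →
    (X u 𝔹.≟ true) ×-dec (covered M u 𝔹.≟ false) ×-dec (Y v 𝔹.≟ true) ×-dec
    (covered M v 𝔹.≟ false) ×-dec (adj G u v 𝔹.≟ true)

  extend : ∀ {k} (M : MatchingIn G X Y k) → Extension M → MatchingIn G X Y (suc k)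
  extend M@(src , tgt , edge , src∈X , tgt∈Y , src-inj , tgt-inj , src≢tgt) (u , v , u∈X , u-free , v∈Y , v-free , uv) =
    u Vec.∷ src , v Vec.∷ tgt , edge′ , src∈X′ , tgt∈Y′ ,
    ∷-injective (proj₁ ∘ u∉M) src-inj , ∷-injective (proj₂ ∘ v∉M) tgt-inj , src≢tgt′
    where
    u∉M = covered-false M u u-free
    v∉M = covered-false M v v-free
    edge′ : ∀ i → adj G ((u Vec.∷ src) i) ((v Vec.∷ tgt) i) ≡ true
    edge′ zero = uv
    edge′ (suc i) = edge i
    src∈X′ : ∀ i → X ((u Vec.∷ src) i) ≡ true
    src∈X′ zero = u∈X
    src∈X′ (suc i) = src∈X i
    tgt∈Y′ : ∀ i → Y ((v Vec.∷ tgt) i) ≡ true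
    tgt∈Y′ zero = v∈Y
    tgt∈Y′ (suc i) = tgt∈Y i
    src≢tgt′ : ∀ i j → (u Vec.∷ src) i ≢ (v Vec.∷ tgt) j
    src≢tgt′ zero zero u≡v = contradiction (trans (sym (subst (λ w → adj G w v ≡ true) u≡v uv)) (loopless G v)) λ ()
    src≢tgt′ zero (suc j) = proj₂ (u∉M j) ∘ sym
    src≢tgt′ (suc i) zero = proj₁ (v∉M i)
    src≢tgt′ (suc i) (suc j) = src≢tgt i j

  greedy : ∀ m → (∀ {k} → k < m → (M : MatchingIn G X Y k) → Extension M) → MatchingIn G X Y m
  greedy zero _ = (λ ()) , (λ ()) , (λ ()) , (λ ()) , (λ ()) , (λ ()) , (λ ()) , (λ ())
  greedy (suc m) ext = extend M (ext ≤-refl M)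
    where M = greedy m λ k<m → ext (m<n⇒m<1+n k<m)

  -- Double counting the edges from covered vertices of X to uncovered vertices of Y.
  ¬Extension⇒count : ∀ {k} (M : MatchingIn G X Y k) → ¬ Extension M → ∀ {p q r m} →
    (∀ v → Y v ≡ true → p ≤ r * d⁻ G X v) → (∀ u → X u ≡ true → q * d⁺ G Y u ≤ m) →
    q * (p * cnt (Y ∖ covered M)) ≤ r * (m * (2 * k))
  ¬Extension⇒count {k} M blocked {p} {q} {r} {m} in-deg out-deg = begin
    q * (p * cnt F)                  ≤⟨ *-monoʳ-≤ q (*-cnt≤sum F _ λ v v∈F → ≤-trans (in-deg v (F⊆Y v v∈F)) (*-monoʳ-≤ r (d⁻≤indeg v v∈F))) ⟩
    q * sum (λ v → r * indeg v)      ≡⟨ cong (q *_) (sym (*-distribˡ-sum r indeg)) ⟩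
    q * (r * sum indeg)              ≡⟨ cong (λ e → q * (r * e)) (cnt-double-counting R) ⟩
    q * (r * sum outdeg)             ≡⟨ *-Comm.x∙yz≈y∙xz q r _ ⟩
    r * (q * sum outdeg)             ≡⟨ cong (r *_) (*-distribˡ-sum q outdeg) ⟩
    r * sum (λ u → q * outdeg u)     ≤⟨ *-monoʳ-≤ r (sum≤*-cnt Z _ q*outdeg≤m outdeg-off-Z) ⟩
    r * (m * cnt Z)                  ≤⟨ *-monoʳ-≤ r (*-monoʳ-≤ m (≤-trans (cnt-mono Z⊆U) (cnt-covered M))) ⟩
    r * (m * (2 * k))                ∎
    where
    open ≤-Reasoning
    U = covered M
    F = Y ∖ U
    Z = U ∩ X
    R : Fin n → Fin n → Bool
    R u v = adj G u v ∧ (Z u ∧ F v)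
    indeg outdeg : Fin n → ℕ
    indeg v = cnt (λ u → R u v)
    outdeg u = cnt (R u)
    F⊆Y : F ⊆ Y
    F⊆Y v h = ∧-conicalˡ _ _ h
    F-uncovered : ∀ v → F v ≡ true → U v ≡ false
    F-uncovered v h = 𝔹.not-injective (∧-conicalʳ _ _ h)
    Z⊆U : Z ⊆ U
    Z⊆U u h = ∧-conicalˡ _ _ h
    d⁻≤indeg : ∀ v → F v ≡ true → d⁻ G X v ≤ indeg v
    d⁻≤indeg v v∈F = cnt-mono λ u h →
      let uv = ∧-conicalˡ (adj G u v) (X u) h ; u∈X = ∧-conicalʳ (adj G u v) (X u) h
          u∈U = 𝔹.¬-not λ u∉U → blocked (u , v , u∈X , u∉U , F⊆Y v v∈F , F-uncovered v v∈F , uv)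
      in ∧-intro uv (∧-intro (∧-intro u∈U u∈X) v∈F)
    q*outdeg≤m : ∀ u → Z u ≡ true → q * outdeg u ≤ m
    q*outdeg≤m u u∈Z = ≤-trans
      (*-monoʳ-≤ q (cnt-mono λ v h →
        ∧-intro (∧-conicalˡ (adj G u v) _ h) (F⊆Y v (∧-conicalʳ (Z u) (F v) (∧-conicalʳ (adj G u v) _ h)))))
      (out-deg u (∧-conicalʳ (U u) (X u) u∈Z))
    outdeg-off-Z : ∀ u → Z u ≡ false → q * outdeg u ≡ 0
    outdeg-off-Z u u∉Z = trans (cong (q *_) (cnt-none (R u) none)) (*-zeroʳ q)
      where
      none : ∀ v → R u v ≡ false
      none v rewrite u∉Z = 𝔹.∧-zeroʳ (adj G u v)

private
  infixl 6 _⊕_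
  infixr 7 _⊛_

  _⊕_ : ∀ {a b c d} → a ≤ b → c ≤ d → a + c ≤ b + d
  _⊕_ = +-mono-≤

  _⊛_ : ∀ k {a b} → a ≤ b → k * a ≤ k * b
  _⊛_ = *-monoʳ-≤

  excess-absurd : ∀ {L R} → L ≤ R → ∀ k → L ≡ R + suc k → ⊥
  excess-absurd {R = R} L≤R k refl = m+1+n≰m R L≤R

d≤2x : ∀ {n a d s t x} → n ≡ 2 * a + d + (s + t) → s ≤ t → n ≤ 2 * (x + (a + s)) → d ≤ 2 * x
d≤2x {a = a} {d} {s} {t} {x} refl s≤t n≤ = +-cancelˡ-≤ (2 * a + 2 * s + t) d (2 * x) (begin
  2 * a + 2 * s + t + d               ≡⟨ lhs a d s t ⟩
  2 * a + d + (s + t) + s             ≤⟨ n≤ ⊕ s≤t ⟩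
  2 * (x + (a + s)) + t               ≡⟨ rhs a s t x ⟩
  2 * a + 2 * s + t + 2 * x           ∎)
  where
  open ≤-Reasoning
  lhs : ∀ a d s t → 2 * a + 2 * s + t + d ≡ 2 * a + d + (s + t) + s
  lhs = solve-∀
  rhs : ∀ a s t x → 2 * (x + (a + s)) + t ≡ 2 * a + 2 * s + t + 2 * x
  rhs = solve-∀

9n<20z : ∀ {n y z} → n ≤ 2 * (y + z) → 20 * y < n → 9 * n < 20 * z
9n<20z {n} {y} {z} n≤ 20y<n = *-cancelˡ-≤ 2 (+-cancelˡ-≤ (2 * n + 40 * y) _ _ (begin
  2 * n + 40 * y + 2 * suc (9 * n)    ≡⟨ lhs n y ⟩
  20 * n + 2 * suc (20 * y)           ≤⟨ 20 ⊛ n≤ ⊕ 2 ⊛ 20y<n ⟩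
  20 * (2 * (y + z)) + 2 * n          ≡⟨ rhs n y z ⟩
  2 * n + 40 * y + 2 * (20 * z)       ∎))
  where
  open ≤-Reasoning
  lhs : ∀ n y → 2 * n + 40 * y + 2 * suc (9 * n) ≡ 20 * n + 2 * suc (20 * y)
  lhs = solve-∀
  rhs : ∀ n y z → 20 * (2 * (y + z)) + 2 * n ≡ 2 * n + 40 * y + 2 * (20 * z)
  rhs = solve-∀

-- The two lemmas below are Farkas certificates: a nonnegative combination of the
-- hypotheses whose left side exceeds its right side by a positive constant.

5c≤2n-absurd : ∀ {a d σ c} → let n = 2 * a + d + σ in 1000 ≤ n → 1000 * σ ≤ n →
  9 * n < 20 * (a + σ) → d ≤ 1 → a ≤ c + d + 2 → 5 * c ≤ 2 * n → ⊥
5c≤2n-absurd {a} {d} {σ} {c} h₁ h₂ h₃ h₄ h₅ h₆ =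
  excess-absurd (h₁ ⊕ h₂ ⊕ 8 ⊛ h₃ ⊕ 70 ⊛ h₄ ⊕ 100 ⊛ h₅ ⊕ 20 ⊛ h₆) (737 + 870 * σ) (certificate a d σ c)
  where
  certificate : ∀ a d σ c →
    1000 + 1000 * σ + 8 * suc (9 * (2 * a + d + σ)) + 70 * d + 100 * a + 20 * (5 * c)
    ≡ (2 * a + d + σ) + (2 * a + d + σ) + 8 * (20 * (a + σ)) + 70 * 1 + 100 * (c + d + 2) + 20 * (2 * (2 * a + d + σ))
      + suc (737 + 870 * σ)
  certificate = solve-∀

10c≤3n-absurd : ∀ {a d σ c} → let n = 2 * a + d + σ in 1000 ≤ n → 1000 * σ ≤ n →
  9 * n < 20 * (a + σ) → a ≤ c + d + 2 → 10 * c ≤ 3 * n → ⊥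
10c≤3n-absurd {a} {d} {σ} {c} h₁ h₂ h₃ h₄ h₅ =
  excess-absurd (h₁ ⊕ h₂ ⊕ 16 ⊛ h₃ ⊕ 100 ⊛ h₄ ⊕ 10 ⊛ h₅) (815 + 4 * a + 12 * d + 792 * σ) (certificate a d σ c)
  where
  certificate : ∀ a d σ c →
    1000 + 1000 * σ + 16 * suc (9 * (2 * a + d + σ)) + 100 * a + 10 * (10 * c)
    ≡ (2 * a + d + σ) + (2 * a + d + σ) + 16 * (20 * (a + σ)) + 100 * (c + d + 2) + 10 * (3 * (2 * a + d + σ))
      + suc (815 + 4 * a + 12 * d + 792 * σ)
  certificate = solve-∀

a≤c+d+2 : ∀ {a d j c} → a + d ≤ 2 * j + c → j ≤ d + 1 → a ≤ c + d + 2
a≤c+d+2 {a} {d} {j} {c} a+d≤ j≤ = +-cancelˡ-≤ d a (c + d + 2) (begin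
  d + a                 ≡⟨ +-comm d a ⟩
  a + d                 ≤⟨ a+d≤ ⟩
  2 * j + c             ≤⟨ +-monoˡ-≤ c (2 ⊛ j≤) ⟩
  2 * (d + 1) + c       ≡⟨ rearrange d c ⟩
  d + (c + d + 2)       ∎)
  where
  open ≤-Reasoning
  rearrange : ∀ d c → 2 * (d + 1) + c ≡ d + (c + d + 2)
  rearrange = solve-∀

5dc≤jn⇒5c≤2n : ∀ {d j c n} → 0 < d → d ≤ 1 → j ≤ d + 1 → 5 * (d * c) ≤ j * n → 5 * c ≤ 2 * n
5dc≤jn⇒5c≤2n {d} {j} {c} {n} d>0 d≤1 j≤ count = begin
  5 * c            ≡⟨ cong (5 *_) (sym (*-identityˡ c)) ⟩
  5 * (1 * c)      ≤⟨ 5 ⊛ *-monoˡ-≤ c d>0 ⟩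
  5 * (d * c)      ≤⟨ count ⟩
  j * n            ≤⟨ *-monoˡ-≤ n j≤ ⟩
  (d + 1) * n      ≤⟨ *-monoˡ-≤ n (+-monoˡ-≤ 1 d≤1) ⟩
  2 * n            ∎
  where open ≤-Reasoning

5dc≤jn⇒10c≤3n : ∀ {d j c n} → 2 ≤ d → j ≤ d + 1 → 5 * (d * c) ≤ j * n → 10 * c ≤ 3 * n
5dc≤jn⇒10c≤3n {d} {j} {c} {n} 2≤d j≤ count = *-cancelˡ-≤ d {{>-nonZero (≤-trans (s≤s z≤n) 2≤d)}} (begin
  d * (10 * c)          ≡⟨ lhs d c ⟩
  2 * (5 * (d * c))     ≤⟨ 2 ⊛ count ⟩
  2 * (j * n)           ≤⟨ 2 ⊛ *-monoˡ-≤ n j≤ ⟩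
  2 * ((d + 1) * n)     ≡⟨ mid d n ⟩
  (2 * d + 2) * n       ≤⟨ *-monoˡ-≤ n (+-monoʳ-≤ (2 * d) 2≤d) ⟩
  (2 * d + d) * n       ≡⟨ rhs d n ⟩
  d * (3 * n)           ∎)
  where
  open ≤-Reasoning
  lhs : ∀ d c → d * (10 * c) ≡ 2 * (5 * (d * c))
  lhs = solve-∀
  mid : ∀ d n → 2 * ((d + 1) * n) ≡ (2 * d + 2) * n
  mid = solve-∀
  rhs : ∀ d n → (2 * d + d) * n ≡ d * (3 * n)
  rhs = solve-∀

-- The implicit arguments are passed explicitly: inferring them would make Agda
-- unfold products with large numerals.
blocked-matching-absurd : ∀ {a d σ j c} → let n = 2 * a + d + σ in 1000 ≤ n → 1000 * σ ≤ n →
  9 * n < 20 * (a + σ) → 0 < d → j ≤ d + 1 → a + d ≤ 2 * j + c → 5 * (d * c) ≤ j * n → ⊥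
blocked-matching-absurd {a} {d} {σ} {j} {c} h₁ h₂ h₃ d>0 j≤ a+d≤ count =
  [ (λ 2≤d → 10c≤3n-absurd {a} {d} {σ} {c} h₁ h₂ h₃ a≤c+d+2′ (5dc≤jn⇒10c≤3n {d} {j} {c} {n} 2≤d j≤ count))
  , (λ d<2 → 5c≤2n-absurd {a} {d} {σ} {c} h₁ h₂ h₃ (≤-pred d<2) a≤c+d+2′
               (5dc≤jn⇒5c≤2n {d} {j} {c} {n} d>0 (≤-pred d<2) j≤ count))
  ]′ (≤-<-connex 2 d)
  where
  n = 2 * a + d + σ
  a≤c+d+2′ = a≤c+d+2 {a} {d} {j} {c} a+d≤ j≤

ε₀ : ℚ
ε₀ = ℤ.+ 1 /ℚ 1000

ℕ→ℚ≡mkℚ : ∀ x → ℕ→ℚ x ≡ mkℚ (ℤ.+ x) 0 (Coprimality.sym (1-coprimeTo x))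
ℕ→ℚ≡mkℚ x = ℚₚ.normalize-coprime _

ℕ→ℚ-nonNeg : ∀ x → NonNegative (ℕ→ℚ x)
ℕ→ℚ-nonNeg x rewrite ℕ→ℚ≡mkℚ x = _

ℕ→ℚ-* : ∀ x y → ℕ→ℚ (x * y) ≡ ℕ→ℚ x *ℚ ℕ→ℚ y
ℕ→ℚ-* x y rewrite ℕ→ℚ≡mkℚ x | ℕ→ℚ≡mkℚ y = cong (_/ℚ 1) (ℤₚ.pos-* x y)

ℕ→ℚ-cancel-≤ : ∀ {x y} → ℕ→ℚ x ≤ℚ ℕ→ℚ y → x ≤ y
ℕ→ℚ-cancel-≤ {x} {y} h rewrite ℕ→ℚ≡mkℚ x | ℕ→ℚ≡mkℚ y =
  ℤₚ.drop‿+≤+ (subst₂ ℤ._≤_ (ℤₚ.*-identityʳ _) (ℤₚ.*-identityʳ _) (ℚₚ.drop-*≤* h))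

≤ε*n⇒1000*≤n : ∀ {ε x n} → ε ≤ℚ ε₀ → ℕ→ℚ x ≤ℚ ε *ℚ ℕ→ℚ n → 1000 * x ≤ n
≤ε*n⇒1000*≤n {ε} {x} {n} ε≤ε₀ x≤εn = ℕ→ℚ-cancel-≤ (begin
  ℕ→ℚ (1000 * x)                   ≡⟨ ℕ→ℚ-* 1000 x ⟩
  ℕ→ℚ 1000 *ℚ ℕ→ℚ x                ≤⟨ ℚₚ.*-monoˡ-≤-nonNeg (ℕ→ℚ 1000) (ℚₚ.≤-trans x≤εn ε*n≤ε₀*n) ⟩
  ℕ→ℚ 1000 *ℚ (ε₀ *ℚ ℕ→ℚ n)        ≡⟨ ℚₚ.*-assoc (ℕ→ℚ 1000) ε₀ (ℕ→ℚ n) ⟨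
  (ℕ→ℚ 1000 *ℚ ε₀) *ℚ ℕ→ℚ n        ≡⟨ ℚₚ.*-identityˡ (ℕ→ℚ n) ⟩
  ℕ→ℚ n                            ∎)
  where
  open ℚₚ.≤-Reasoning
  ε*n≤ε₀*n : ε *ℚ ℕ→ℚ n ≤ℚ ε₀ *ℚ ℕ→ℚ n
  ε*n≤ε₀*n = ℚₚ.*-monoʳ-≤-nonNeg (ℕ→ℚ n) {{ℕ→ℚ-nonNeg n}} ε≤ε₀

module _ {n} (G : Digraph n) (P : Fin n → Part) where
  private
    A B S T : Fin n → Bool
    A = memb P pA
    B = memb P pB
    S = memb P pS
    T = memb P pT
    a b s t : ℕ
    a = cnt A
    b = cnt B
    s = cnt S
    t = cnt T

  Q9⇒B∪T-sparse : ∀ {ε} → Q9 G P ε → a < b → ∀ x → (B ∪ T) x ≡ true → 20 * d⁺ G B x < n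
  Q9⇒B∪T-sparse q9 a<b x x∈B∪T =
    [ (λ x∈B → proj₁ (proj₁ (q9 a<b) x x∈B)) , proj₂ (proj₂ (q9 a<b)) x ]′ (∨-true (B x) (T x) x∈B∪T)

  private
    cover-B∪T : ∀ y → ((B ∪ T) ∪ (A ∪ S)) y ≡ true
    cover-B∪T y = by-part (P y)
      where
      by-part : ∀ p → (is pB p ∨ is pT p) ∨ (is pA p ∨ is pS p) ≡ true
      by-part pA = refl
      by-part pB = refl
      by-part pS = refl
      by-part pT = refl

    cover-B : ∀ y → (B ∪ (A ∪ (S ∪ T))) y ≡ true
    cover-B y = by-part (P y)
      where
      by-part : ∀ p → is pB p ∨ (is pA p ∨ (is pS p ∨ is pT p)) ≡ true
      by-part pA = refl
      by-part pB = refl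
      by-part pS = refl
      by-part pT = refl

  module _ (δ : δ⁰≥half G) (s≤t : s ≤ t) (B∪T-sparse : ∀ x → (B ∪ T) x ≡ true → 20 * d⁺ G B x < n)
           (1000≤n : 1000 ≤ n) (1000σ≤n : 1000 * (s + t) ≤ n) {d} (d>0 : 0 < d) (b≡a+d : b ≡ a + d) where

    n≡ : n ≡ 2 * a + d + (s + t)
    n≡ = begin
      n                      ≡⟨ cnt-parts P ⟨
      a + b + s + t          ≡⟨ cong (λ b → a + b + s + t) b≡a+d ⟩
      a + (a + d) + s + t    ≡⟨ rearrange a d s t ⟩
      2 * a + d + (s + t)    ∎
      where
      open ≡-Reasoning
      rearrange : ∀ a d s t → a + (a + d) + s + t ≡ 2 * a + d + (s + t)
      rearrange = solve-∀

    in-degree-B∪T : ∀ v → d ≤ 2 * d⁻ G (B ∪ T) v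
    in-degree-B∪T v = d≤2x {n} {a} {d} {s} {t} {d⁻ G (B ∪ T) v} n≡ s≤t (begin
      n                                   ≤⟨ proj₂ (δ v) ⟩
      2 * d⁻ G Vall v                     ≤⟨ 2 ⊛ d⁻-cover G {B ∪ T} {A ∪ S} cover-B∪T v ⟩
      2 * (d⁻ G (B ∪ T) v + cnt (A ∪ S))  ≤⟨ 2 ⊛ +-monoʳ-≤ (d⁻ G (B ∪ T) v) (cnt-∪ A S) ⟩
      2 * (d⁻ G (B ∪ T) v + (a + s))      ∎)
      where open ≤-Reasoning

    A∪S∪T-large : 9 * n < 20 * (a + (s + t))
    A∪S∪T-large = 9n<20z {n} {d⁺ G B v₀} {a + (s + t)} (begin
      n                                          ≤⟨ proj₁ (δ v₀) ⟩
      2 * d⁺ G Vall v₀                           ≤⟨ 2 ⊛ d⁺-cover G cover-B v₀ ⟩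
      2 * (d⁺ G B v₀ + cnt (A ∪ (S ∪ T)))        ≤⟨ 2 ⊛ +-monoʳ-≤ (d⁺ G B v₀) |A∪S∪T| ⟩
      2 * (d⁺ G B v₀ + (a + (s + t)))            ∎)
      (B∪T-sparse v₀ (⊆-∪ˡ {X = B} {T} v₀ (proj₂ witness)))
      where
      open ≤-Reasoning
      witness = cnt-witness B (subst (0 <_) (sym b≡a+d) (<-≤-trans d>0 (m≤n+m d a)))
      v₀ = proj₁ witness
      |A∪S∪T| : cnt (A ∪ (S ∪ T)) ≤ a + (s + t)
      |A∪S∪T| = ≤-trans (cnt-∪ A (S ∪ T)) (+-monoʳ-≤ a (cnt-∪ S T))

    short-matchings-extend : ∀ {j} → j < d + 2 → (M : MatchingIn G (B ∪ T) B j) → Extension G (B ∪ T) B M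
    short-matchings-extend {j} j<d+2 M = decidable-stable (extension? G (B ∪ T) B M) λ blocked →
      blocked-matching-absurd {a} {d} {s + t} {j} {c}
        (subst (1000 ≤_) n≡ 1000≤n) (subst (λ m → 1000 * (s + t) ≤ m) n≡ 1000σ≤n)
        (subst (λ m → 9 * m < 20 * (a + (s + t))) n≡ A∪S∪T-large) d>0 j≤d+1 a+d≤2j+c
        (subst (λ m → 5 * (d * c) ≤ j * m) n≡ (edge-count blocked))
      where
      open ≤-Reasoning
      c = cnt (B ∖ covered G (B ∪ T) B M)
      j≤d+1 : j ≤ d + 1
      j≤d+1 = m<1+n⇒m≤n (subst (j <_) (+-suc d 1) j<d+2)
      a+d≤2j+c : a + d ≤ 2 * j + c
      a+d≤2j+c = subst (_≤ 2 * j + c) b≡a+d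
        (≤-trans (cnt≤cnt+cnt-∖ B (covered G (B ∪ T) B M)) (+-monoˡ-≤ c (cnt-covered G (B ∪ T) B M)))
      edge-count : ¬ Extension G (B ∪ T) B M → 5 * (d * c) ≤ j * n
      edge-count blocked = *-cancelˡ-≤ 4 (begin
        4 * (5 * (d * c))     ≡⟨ *-assoc 4 5 (d * c) ⟨
        20 * (d * c)          ≤⟨ ¬Extension⇒count G (B ∪ T) B M blocked {d} {20} {2} {n}
                                   (λ v _ → in-degree-B∪T v) (λ u u∈B∪T → <⇒≤ (B∪T-sparse u u∈B∪T)) ⟩
        2 * (n * (2 * j))     ≡⟨ rearrange n j ⟩
        4 * (j * n)           ∎)
        where
        rearrange : ∀ n j → 2 * (n * (2 * j)) ≡ 4 * (j * n)
        rearrange = solve-∀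

    matching-B∪T→B : MatchingIn G (B ∪ T) B (d + 2)
    matching-B∪T→B = greedy G (B ∪ T) B (d + 2) short-matchings-extend

proposition6p2 : ∃[ f₀ ] ∃[ f₁ ] HierFun f₀ × HierFun f₁ ×
    (∀ (ε : ℚ) (n : ℕ) → 0ℚ <ℚ ε → ε ≤ℚ f₁ 1ℚ → 1ℚ ≤ℚ f₀ ε *ℚ ℕ→ℚ n →
     (G : Digraph n) → δ⁰≥half G →
     (P : Fin n → Part) → Q1-9 G P ε →
     (d : ℕ) → 0 < d → cnt (memb P pB) ≡ cnt (memb P pA) + d →
     MatchingIn G (λ x → memb P pB x ∨ memb P pT x) (memb P pB) (d + 2))
proposition6p2 =
  (λ ε → ε) , (λ _ → ε₀) , ((λ _ _ _ ε≤ε′ → ε≤ε′) , (λ _ ε>0 → ε>0)) , ((λ _ _ _ _ → ℚₚ.≤-refl) , (λ _ _ → ℚₚ.positive⁻¹ ε₀)) ,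
  λ ε n _ ε≤ε₀ 1≤εn G δ P (q1 , _ , _ , _ , _ , q6 , _ , _ , q9) d d>0 b≡a+d →
    let a<b = subst (cnt (memb P pA) <_) (sym b≡a+d) (m<m+n (cnt (memb P pA)) d>0) in
    matching-B∪T→B G P δ (proj₂ q1) (Q9⇒B∪T-sparse G P {ε} q9 a<b)
      (≤ε*n⇒1000*≤n {x = 1} ε≤ε₀ 1≤εn) (≤ε*n⇒1000*≤n {x = cnt (memb P pS) + cnt (memb P pT)} ε≤ε₀ q6) d>0 b≡a+d
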